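{- Let $G$ and $H$ be two connected graphs of orders $n,m\in\mathbb{N}$. Then $\gamma_{sp}(G\star H)\leq n(\gamma_{sp}(H)+1)$.
   Context: All graphs are finite, simple, undirected. For $S\subseteq V(G)$, $\overline{S}=V(G)\setminus S$ and $N(v)$ denotes the open neighbourhood of $v$. A set $S$ is a super dominating set of $G$ if every vertex of $\overline{S}$ has a neighbour in $S$ and for every $u\in\overline{S}$ there is $v\in S$ with $N(v)\cap\overline{S}=\{u\}$. The super domination number $\gamma_{sp}(G)$ is the minimum cardinality of a super dominating set of $G$. The neighbourhood corona product $G\star H$ is the graph obtained by taking one copy of $G$ and $|V(G)|$ disjoint copies of $H$, one copy $H_w$ for each vertex $w$ of $G$, and joining every neighbour (in $G$) of $w$ to every vertex of $H_w$, for each $w\in V(G)$. -}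

module Defs where

open import Data.Nat using (ℕ; _+_; _*_; _≤_)
open import Data.Fin using (Fin; splitAt; remQuot; _≟_)
open import Data.Fin.Subset using (Subset; _∈_; _∉_; ∣_∣)
open import Data.Bool using (Bool; true; false; _∧_)
open import Data.Product using (Σ; _×_; _,_; ∃)
open import Data.Sum using (_⊎_; inj₁; inj₂)
open import Relation.Nullary using (does; yes; no)
open import Relation.Binary.PropositionalEquality using (_≡_; refl; sym)

record Graph (n : ℕ) : Set where
  field
    adj    : Fin n → Fin n → Bool
    symm   : ∀ u v → adj u v ≡ adj v u
    irrefl : ∀ u → adj u u ≡ false
open Graph public

Adj : ∀ {n} → Graph n → Fin n → Fin n → Set
Adj G u v = adj G u v ≡ true

data Reach {n} (G : Graph n) : Fin n → Fin n → Set where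
  here : ∀ {u} → Reach G u u
  step : ∀ {u v w} → Adj G u v → Reach G v w → Reach G u w

Connected : ∀ {n} → Graph n → Set
Connected G = ∀ u v → Reach G u v

IsSuperDominating : ∀ {n} → Graph n → Subset n → Set
IsSuperDominating G S =
  (∀ u → u ∉ S → ∃ λ v → v ∈ S × Adj G v u)
  × (∀ u → u ∉ S → ∃ λ v → v ∈ S × Adj G v u
        × (∀ w → w ∉ S → Adj G v w → w ≡ u))

IsSuperDomNumber : ∀ {n} → Graph n → ℕ → Set
IsSuperDomNumber G k =
  (∃ λ S → IsSuperDominating G S × ∣ S ∣ ≡ k)
  × (∀ S → IsSuperDominating G S → k ≤ ∣ S ∣)

-- Neighbourhood corona product.  Vertices of G ⋆ H are Fin (n + n * m):
-- the first n are the copy of G; a vertex i ↑ʳ c with remQuot m c = (w , h)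
-- is vertex h of the copy H_w.
Vtx : ℕ → ℕ → Set
Vtx n m = Fin n ⊎ (Fin n × Fin m)

cls : ∀ {n m} → Fin (n + n * m) → Vtx n m
cls {n} {m} x with splitAt n x
... | inj₁ g = inj₁ g
... | inj₂ c = inj₂ (remQuot m c)

eqb : ∀ {n} → Fin n → Fin n → Bool
eqb a b = does (a ≟ b)

eqb-sym : ∀ {n} (a b : Fin n) → eqb a b ≡ eqb b a
eqb-sym a b with a ≟ b | b ≟ a
... | yes _ | yes _ = refl
... | no _  | no _  = refl
... | yes p | no q  with q (sym p)
... | ()
eqb-sym a b | no q | yes p with q (sym p)
... | ()

adjV : ∀ {n m} → Graph n → Graph m → Vtx n m → Vtx n m → Bool
adjV G H (inj₁ g) (inj₁ g′) = adj G g g′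
adjV G H (inj₁ g) (inj₂ (w , h)) = adj G g w
adjV G H (inj₂ (w , h)) (inj₁ g) = adj G g w
adjV G H (inj₂ (w , h)) (inj₂ (w′ , h′)) = eqb w w′ ∧ adj H h h′

adjV-sym : ∀ {n m} (G : Graph n) (H : Graph m) x y → adjV G H x y ≡ adjV G H y x
adjV-sym G H (inj₁ g) (inj₁ g′) = symm G g g′
adjV-sym G H (inj₁ g) (inj₂ _) = refl
adjV-sym G H (inj₂ _) (inj₁ g) = refl
adjV-sym G H (inj₂ (w , h)) (inj₂ (w′ , h′))
  rewrite eqb-sym w w′ | symm H h h′ = refl

∧-false : ∀ b → b ∧ false ≡ false
∧-false true = refl
∧-false false = refl

adjV-irr : ∀ {n m} (G : Graph n) (H : Graph m) x → adjV G H x x ≡ false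
adjV-irr G H (inj₁ g) = irrefl G g
adjV-irr G H (inj₂ (w , h)) rewrite irrefl H h = ∧-false (eqb w w)

_⋆_ : ∀ {n m} → Graph n → Graph m → Graph (n + n * m)
G ⋆ H = record
  { adj    = λ x y → adjV G H (cls x) (cls y)
  ; symm   = λ x y → adjV-sym G H (cls x) (cls y)
  ; irrefl = λ x → adjV-irr G H (cls x)
  }

{-# OPTIONS --safe #-}
-- Take all of V(G) together with a copy of a minimum super dominating set S_H of H inside
-- every copy H_w.  A vertex (w , h) outside this set has h ∉ S_H, so h has a dominator
-- h′ ∈ S_H in H whose only neighbour outside S_H is h.  The copy (w , h′) then works in
-- G ⋆ H: its other neighbours are neighbours of w in G, which all lie in the set.  The set
-- has n + n γ_sp(H) elements.
module Submission where

open import Defs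
open import Data.Nat using (ℕ; zero; suc; _+_; _*_; _≤_)
open import Data.Nat.Properties using (*-suc; +-comm; ≤-trans; ≤-reflexive)
open import Data.Bool using (Bool; true; false)
open import Data.Fin using (Fin; splitAt; remQuot; combine; _↑ˡ_; _↑ʳ_; _≟_)
open import Data.Fin.Properties
  using (splitAt⁻¹-↑ˡ; splitAt⁻¹-↑ʳ; splitAt-↑ʳ; remQuot-combine; combine-remQuot)
open import Data.Fin.Subset using (Subset; _∈_; _∉_; ∣_∣; ⊤)
open import Data.Fin.Subset.Properties using (∣⊤∣≡n)
open import Data.Vec using (Vec; []; _∷_; _++_; concat; replicate; lookup)
open import Data.Vec.Properties
  using (lookup-splitAt; lookup-concat; lookup-replicate; []=⇒lookup; lookup⇒[]=)
open import Data.Product using (_×_; _,_; ∃; ∃₂; proj₁; proj₂)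
open import Data.Sum using (inj₁; inj₂)
open import Relation.Nullary using (yes; no; contradiction)
open import Relation.Binary.PropositionalEquality
  using (_≡_; refl; sym; trans; cong; cong₂; subst₂; module ≡-Reasoning)

PrivatelyDominated : ∀ {n} → Graph n → Subset n → Fin n → Set
PrivatelyDominated G S u = ∃ λ v → v ∈ S × Adj G v u × (∀ w → w ∉ S → Adj G v w → w ≡ u)

privatelyDominated⇒superDominating : ∀ {n} (G : Graph n) (S : Subset n) →
  (∀ u → u ∉ S → PrivatelyDominated G S u) → IsSuperDominating G S
privatelyDominated⇒superDominating G S dominator =
  (λ u u∉S → let v , v∈S , vu , _ = dominator u u∉S in v , v∈S , vu) , dominator

∣p++q∣≡∣p∣+∣q∣ : ∀ {a b} (p : Subset a) (q : Subset b) → ∣ p ++ q ∣ ≡ ∣ p ∣ + ∣ q ∣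
∣p++q∣≡∣p∣+∣q∣ []          q = refl
∣p++q∣≡∣p∣+∣q∣ (true ∷ p)  q = cong suc (∣p++q∣≡∣p∣+∣q∣ p q)
∣p++q∣≡∣p∣+∣q∣ (false ∷ p) q = ∣p++q∣≡∣p∣+∣q∣ p q

∣concat-replicate∣ : ∀ {b} a (p : Subset b) → ∣ concat (replicate a p) ∣ ≡ a * ∣ p ∣
∣concat-replicate∣ zero    p = refl
∣concat-replicate∣ (suc a) p =
  trans (∣p++q∣≡∣p∣+∣q∣ p (concat (replicate a p))) (cong (∣ p ∣ +_) (∣concat-replicate∣ a p))

lookup-concat-replicate : ∀ {A : Set} a {b} (xs : Vec A b) (c : Fin (a * b)) →
  lookup (concat (replicate a xs)) c ≡ lookup xs (proj₂ (remQuot {a} b c))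
lookup-concat-replicate a {b} xs c = begin
  lookup xss c                          ≡⟨ cong (lookup xss) (sym (combine-remQuot {a} b c)) ⟩
  lookup xss (combine w h)              ≡⟨ lookup-concat (replicate a xs) w h ⟩
  lookup (lookup (replicate a xs) w) h  ≡⟨ cong (λ ys → lookup ys h) (lookup-replicate w xs) ⟩
  lookup xs h                           ∎
  where
  open ≡-Reasoning
  xss = concat (replicate a xs)
  w = proj₁ (remQuot {a} b c)
  h = proj₂ (remQuot {a} b c)

module _ {n m : ℕ} where

  fromVtx : Vtx n m → Fin (n + n * m)
  fromVtx (inj₁ g)       = g ↑ˡ (n * m)
  fromVtx (inj₂ (w , h)) = n ↑ʳ combine w h

  fromVtx∘cls : ∀ x → fromVtx (cls x) ≡ x
  fromVtx∘cls x with splitAt n x in eq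
  ... | inj₁ g = splitAt⁻¹-↑ˡ eq
  ... | inj₂ c = trans (cong (n ↑ʳ_) (combine-remQuot {n} m c)) (splitAt⁻¹-↑ʳ eq)

  cls∘fromVtx-copy : ∀ w h → cls (fromVtx (inj₂ (w , h))) ≡ inj₂ (w , h)
  cls∘fromVtx-copy w h
    rewrite splitAt-↑ʳ n (n * m) (combine w h) | remQuot-combine {n} {m} w h = refl

  cls-injective : ∀ x y → cls x ≡ cls y → x ≡ y
  cls-injective x y eq = trans (sym (fromVtx∘cls x)) (trans (cong fromVtx eq) (fromVtx∘cls y))

  module _ (G : Graph n) (H : Graph m) where

    adjV-copy⁺ : ∀ w {h h′} → Adj H h h′ → adjV G H (inj₂ (w , h)) (inj₂ (w , h′)) ≡ true
    adjV-copy⁺ w hh′ with w ≟ w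
    ... | yes _  = hh′
    ... | no w≢w = contradiction refl w≢w

    adjV-copy⁻ : ∀ {w w′ h h′} → adjV G H (inj₂ (w , h)) (inj₂ (w′ , h′)) ≡ true →
                 w ≡ w′ × Adj H h h′
    adjV-copy⁻ {w} {w′} {h} {h′} adjacent with w ≟ w′ | adj H h h′
    ... | yes w≡w′ | true = w≡w′ , refl

  baseWithCopies : Subset m → Subset (n + n * m)
  baseWithCopies SH = ⊤ ++ concat (replicate n SH)

  ∣baseWithCopies∣ : ∀ SH → ∣ baseWithCopies SH ∣ ≡ n * (∣ SH ∣ + 1)
  ∣baseWithCopies∣ SH = begin
    ∣ ⊤ {n} ++ concat (replicate n SH) ∣  ≡⟨ ∣p++q∣≡∣p∣+∣q∣ (⊤ {n}) (concat (replicate n SH)) ⟩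
    ∣ ⊤ {n} ∣ + ∣ concat (replicate n SH) ∣ ≡⟨ cong₂ _+_ (∣⊤∣≡n n) (∣concat-replicate∣ n SH) ⟩
    n + n * ∣ SH ∣                          ≡⟨ sym (*-suc n ∣ SH ∣) ⟩
    n * suc ∣ SH ∣                          ≡⟨ cong (n *_) (+-comm 1 ∣ SH ∣) ⟩
    n * (∣ SH ∣ + 1)                        ∎
    where open ≡-Reasoning

  module _ (SH : Subset m) where

    inBaseWithCopies : Vtx n m → Bool
    inBaseWithCopies (inj₁ _)       = true
    inBaseWithCopies (inj₂ (_ , h)) = lookup SH h

    lookup-baseWithCopies : ∀ x → lookup (baseWithCopies SH) x ≡ inBaseWithCopies (cls x)
    lookup-baseWithCopies x
      rewrite lookup-splitAt n (⊤ {n}) (concat (replicate n SH)) x with splitAt n x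
    ... | inj₁ g = lookup-replicate g true
    ... | inj₂ c = lookup-concat-replicate n SH c

    ∈baseWithCopies : ∀ x → inBaseWithCopies (cls x) ≡ true → x ∈ baseWithCopies SH
    ∈baseWithCopies x inX = lookup⇒[]= x _ (trans (lookup-baseWithCopies x) inX)

    ∉baseWithCopies : ∀ x → x ∉ baseWithCopies SH →
                      ∃₂ λ w h → cls x ≡ inj₂ (w , h) × h ∉ SH
    ∉baseWithCopies x x∉ with cls x in eq
    ... | inj₁ _       = contradiction (∈baseWithCopies x (cong inBaseWithCopies eq)) x∉
    ... | inj₂ (w , h) = w , h , eq , λ h∈SH →
      x∉ (∈baseWithCopies x (trans (cong inBaseWithCopies eq) ([]=⇒lookup h∈SH)))

    baseWithCopies-privatelyDominated :
      ∀ (G : Graph n) (H : Graph m) → IsSuperDominating H SH →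
      ∀ u → u ∉ baseWithCopies SH → PrivatelyDominated (G ⋆ H) (baseWithCopies SH) u
    baseWithCopies-privatelyDominated G H (_ , privateH) u u∉
      with ∉baseWithCopies u u∉
    ... | w , h , u≡ , h∉SH with privateH h h∉SH
    ... | h′ , h′∈SH , h′h , h′-private = v , v∈ , vu , v-private
      where
      v = fromVtx (inj₂ (w , h′))

      v∈ : v ∈ baseWithCopies SH
      v∈ = ∈baseWithCopies v
             (trans (cong inBaseWithCopies (cls∘fromVtx-copy w h′)) ([]=⇒lookup h′∈SH))

      vu : Adj (G ⋆ H) v u
      vu = subst₂ (λ p q → adjV G H p q ≡ true) (sym (cls∘fromVtx-copy w h′)) (sym u≡)
             (adjV-copy⁺ G H w h′h)

      v-private : ∀ y → y ∉ baseWithCopies SH → Adj (G ⋆ H) v y → y ≡ u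
      v-private y y∉ vy with ∉baseWithCopies y y∉
      ... | w′ , h″ , y≡ , h″∉SH
        with adjV-copy⁻ G H {w} {w′} {h′} {h″} (subst₂ (λ p q → adjV G H p q ≡ true) (cls∘fromVtx-copy w h′) y≡ vy)
      ... | refl , h′h″ with h′-private h″ h″∉SH h′h″
      ... | refl = cls-injective y u (trans y≡ (sym u≡))

theorem3p2 : ∀ {n m} (G : Graph n) (H : Graph m) → Connected G → Connected H →
    ∀ k j → IsSuperDomNumber H k → IsSuperDomNumber (G ⋆ H) j → j ≤ n * (k + 1)
theorem3p2 {n} G H _ _ k j ((SH , SH-superDominating , ∣SH∣≡k) , _) (_ , j-minimum) =
  ≤-trans (j-minimum S S-superDominating) (≤-reflexive ∣S∣≡)
  where
  S = baseWithCopies {n} SH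

  S-superDominating : IsSuperDominating (G ⋆ H) S
  S-superDominating = privatelyDominated⇒superDominating (G ⋆ H) S
    (baseWithCopies-privatelyDominated SH G H SH-superDominating)

  ∣S∣≡ : ∣ S ∣ ≡ n * (k + 1)
  ∣S∣≡ = trans (∣baseWithCopies∣ {n} SH) (cong (λ s → n * (s + 1)) ∣SH∣≡k)
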